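{- For every positive integer $n$ and every $p\in\mathbb{N}_0$, \[ \sum_{k=1}^nkH_{p+k}^2=\frac{(n-p)(n+p+1)}{2}H_{p+n}^2-\frac{n^2-n-1-p(2n+3p+3)}{2}H_{p+n}+\frac{p(p+1)}{2}H_{p}^2-\frac{3p^2+3p+1}{2}H_{p}+\frac{n(n-6p-3)}{4}. \]
   Context: $H_0=0$ and $H_m=\sum_{j=1}^m \frac1j$ for $m\ge1$. -}

module Defs where

open import Data.Nat as ℕ using (ℕ; zero; suc)
open import Data.Integer as ℤ using (ℤ)
open import Data.Rational using (ℚ; 0ℚ; 1ℚ; _+_; _*_; _-_; _/_)

nat : ℕ → ℚ
nat n = ℤ.+ n / 1

H : ℕ → ℚ
H zero = 0ℚ
H (suc m) = H m + (ℤ.+ 1) / suc m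

sum1 : ℕ → (ℕ → ℚ) → ℚ
sum1 zero f = 0ℚ
sum1 (suc n) f = sum1 n f + f (suc n)

-- Write R(n) for the right-hand side. R(0) = 0 identically, and since H (p + n + 1) = H (p + n) + u
-- with u (p + n + 1) = 1, the increment R(n + 1) − R(n) − (n + 1) H (p + n + 1)² is a polynomial in
-- n, p, H (p + n), u that is a multiple of u (p + n + 1) − 1, hence zero; the sum telescopes.
module Submission where

open import Defs
open import Data.Nat as ℕ using (ℕ; NonZero; zero; suc)
open import Data.Nat.Coprimality using (1-coprimeTo) renaming (sym to coprime-sym)
import Data.Nat.Properties as ℕ
open import Data.Integer as ℤ using (ℤ)
import Data.Integer.Properties as ℤ
open import Data.Rational using (ℚ; mkℚ; 0ℚ; 1ℚ; toℚᵘ; _+_; _*_; _-_; _/_)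
open import Data.Rational.Properties
  using (normalize-coprime; toℚᵘ-injective; toℚᵘ-homo-+; *-inverseˡ)
import Data.Rational.Unnormalised as ℚᵘ
import Data.Rational.Unnormalised.Properties as ℚᵘ
open import Data.Rational.Solver using (module +-*-Solver)
open +-*-Solver using (Polynomial; con; _:+_; _:*_; _:-_; _:=_; solve)
open import Relation.Binary.PropositionalEquality

nat≡mkℚ : ∀ n → nat n ≡ mkℚ (ℤ.+ n) 0 (coprime-sym (1-coprimeTo n))
nat≡mkℚ n = normalize-coprime (coprime-sym (1-coprimeTo n))

mkℚᵘ-+ : ∀ m n → ℚᵘ.mkℚᵘ (ℤ.+ (m ℕ.+ n)) 0 ℚᵘ.≃ ℚᵘ.mkℚᵘ (ℤ.+ m) 0 ℚᵘ.+ ℚᵘ.mkℚᵘ (ℤ.+ n) 0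
mkℚᵘ-+ m n = ℚᵘ.*≡* (begin
  ℤ.+ (m ℕ.+ n) ℤ.* ℤ.1ℤ                        ≡⟨ ℤ.*-identityʳ _ ⟩
  ℤ.+ (m ℕ.+ n)                                  ≡⟨ ℤ.pos-+ m n ⟩
  ℤ.+ m ℤ.+ ℤ.+ n                                ≡⟨ cong₂ ℤ._+_ (ℤ.*-identityʳ (ℤ.+ m)) (ℤ.*-identityʳ (ℤ.+ n)) ⟨
  ℤ.+ m ℤ.* ℤ.1ℤ ℤ.+ ℤ.+ n ℤ.* ℤ.1ℤ             ≡⟨ ℤ.*-identityʳ _ ⟨
  (ℤ.+ m ℤ.* ℤ.1ℤ ℤ.+ ℤ.+ n ℤ.* ℤ.1ℤ) ℤ.* ℤ.1ℤ  ∎)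
  where open ≡-Reasoning

nat-+ : ∀ m n → nat (m ℕ.+ n) ≡ nat m + nat n
nat-+ m n = toℚᵘ-injective (begin-equality
  toℚᵘ (nat (m ℕ.+ n))                      ≡⟨ cong toℚᵘ (nat≡mkℚ (m ℕ.+ n)) ⟩
  ℚᵘ.mkℚᵘ (ℤ.+ (m ℕ.+ n)) 0                 ≃⟨ mkℚᵘ-+ m n ⟩
  ℚᵘ.mkℚᵘ (ℤ.+ m) 0 ℚᵘ.+ ℚᵘ.mkℚᵘ (ℤ.+ n) 0  ≡⟨ cong₂ (λ a b → toℚᵘ a ℚᵘ.+ toℚᵘ b) (nat≡mkℚ m) (nat≡mkℚ n) ⟨
  toℚᵘ (nat m) ℚᵘ.+ toℚᵘ (nat n)            ≃⟨ toℚᵘ-homo-+ (nat m) (nat n) ⟨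
  toℚᵘ (nat m + nat n)                      ∎)
  where open ℚᵘ.≤-Reasoning

1/suc-inverseˡ : ∀ m → (ℤ.+ 1 / suc m) * nat (suc m) ≡ 1ℚ
1/suc-inverseˡ m rewrite nat≡mkℚ (suc m) | normalize-coprime (1-coprimeTo (suc m)) =
  *-inverseˡ (mkℚ (ℤ.+ suc m) 0 (coprime-sym (1-coprimeTo (suc m))))

sum1-closed-form : (f g : ℕ → ℚ) → g 0 ≡ 0ℚ → (∀ n → g n + f (suc n) ≡ g (suc n)) →
                   ∀ n → sum1 n f ≡ g n
sum1-closed-form f g g-zero g-suc zero    = sym g-zero
sum1-closed-form f g g-zero g-suc (suc n) =
  trans (cong (_+ f (suc n)) (sum1-closed-form f g g-zero g-suc n)) (g-suc n)

closedForm : ℚ → ℚ → ℚ → ℚ → ℚ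
closedForm N P x h =
    (((N - P) * (N + P + nat 1)) * (x * x)) * (ℤ.+ 1 / 2)
  - ((N * N - N - nat 1 - P * (nat 2 * N + nat 3 * P + nat 3)) * x) * (ℤ.+ 1 / 2)
  + ((P * (P + nat 1)) * (h * h)) * (ℤ.+ 1 / 2)
  - ((nat 3 * P * P + nat 3 * P + nat 1) * h) * (ℤ.+ 1 / 2)
  + (N * (N - nat 6 * P - nat 3)) * (ℤ.+ 1 / 4)

closedFormᴾ : ∀ {m} → Polynomial m → Polynomial m → Polynomial m → Polynomial m → Polynomial m
closedFormᴾ N P x h =
    (((N :- P) :* (N :+ P :+ con (nat 1))) :* (x :* x)) :* con (ℤ.+ 1 / 2)
  :- ((N :* N :- N :- con (nat 1) :- P :* (con (nat 2) :* N :+ con (nat 3) :* P :+ con (nat 3))) :* x) :* con (ℤ.+ 1 / 2)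
  :+ ((P :* (P :+ con (nat 1))) :* (h :* h)) :* con (ℤ.+ 1 / 2)
  :- ((con (nat 3) :* P :* P :+ con (nat 3) :* P :+ con (nat 1)) :* h) :* con (ℤ.+ 1 / 2)
  :+ (N :* (N :- con (nat 6) :* P :- con (nat 3))) :* con (ℤ.+ 1 / 4)

closedForm-zero : ∀ P h → closedForm 0ℚ P h h ≡ 0ℚ
closedForm-zero = solve 2 (λ P h → closedFormᴾ (con 0ℚ) P h h := con 0ℚ) refl

closedForm-suc : ∀ N P x u h → u * (1ℚ + (P + N)) ≡ 1ℚ →
                 closedForm N P x h + (1ℚ + N) * ((x + u) * (x + u)) ≡ closedForm (1ℚ + N) P (x + u) h
closedForm-suc N P x u h u-inverse = begin
  lhs                                  ≡⟨ solve 2 (λ a b → a := a :+ b :* (con 1ℚ :- con 1ℚ)) refl lhs c ⟩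
  lhs + c * (1ℚ - 1ℚ)                  ≡⟨ cong (λ t → lhs + c * (t - 1ℚ)) u-inverse ⟨
  lhs + c * (u * (1ℚ + (P + N)) - 1ℚ)  ≡⟨ certificate ⟩
  closedForm (1ℚ + N) P (x + u) h      ∎
  where
  open ≡-Reasoning
  lhs c : ℚ
  lhs = closedForm N P x h + (1ℚ + N) * ((x + u) * (x + u))
  c = (N - P) * x + (N - P) * u * (ℤ.+ 1 / 2) - (N - nat 3 * P - 1ℚ) * (ℤ.+ 1 / 2)
  certificate : lhs + c * (u * (1ℚ + (P + N)) - 1ℚ) ≡ closedForm (1ℚ + N) P (x + u) h
  certificate = solve 5 (λ N P x u h →
    closedFormᴾ N P x h :+ (con 1ℚ :+ N) :* ((x :+ u) :* (x :+ u))
      :+ ((N :- P) :* x :+ (N :- P) :* u :* con (ℤ.+ 1 / 2) :- (N :- con (nat 3) :* P :- con 1ℚ) :* con (ℤ.+ 1 / 2))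
         :* (u :* (con 1ℚ :+ (P :+ N)) :- con 1ℚ)
    := closedFormᴾ (con 1ℚ :+ N) P (x :+ u) h) refl N P x u h

corollary11 : (n p : ℕ) → .{{_ : NonZero n}} →
    sum1 n (λ k → nat k * (H (p ℕ.+ k) * H (p ℕ.+ k)))
      ≡ (((nat n - nat p) * (nat n + nat p + nat 1)) * (H (p ℕ.+ n) * H (p ℕ.+ n))) * (ℤ.+ 1 / 2)
        - ((nat n * nat n - nat n - nat 1 - nat p * (nat 2 * nat n + nat 3 * nat p + nat 3)) * H (p ℕ.+ n)) * (ℤ.+ 1 / 2)
        + ((nat p * (nat p + nat 1)) * (H p * H p)) * (ℤ.+ 1 / 2)
        - ((nat 3 * nat p * nat p + nat 3 * nat p + nat 1) * H p) * (ℤ.+ 1 / 2)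
        + (nat n * (nat n - nat 6 * nat p - nat 3)) * (ℤ.+ 1 / 4)
corollary11 n p = sum1-closed-form summand value value-zero value-suc n
  where
  summand value : ℕ → ℚ
  summand k = nat k * (H (p ℕ.+ k) * H (p ℕ.+ k))
  value k = closedForm (nat k) (nat p) (H (p ℕ.+ k)) (H p)

  value-zero : value 0 ≡ 0ℚ
  value-zero rewrite ℕ.+-identityʳ p = closedForm-zero (nat p) (H p)

  value-suc : ∀ k → value k + summand (suc k) ≡ value (suc k)
  value-suc k rewrite ℕ.+-suc p k | nat-+ 1 k =
    closedForm-suc (nat k) (nat p) (H (p ℕ.+ k)) u (H p) u-inverse
    where
    open ≡-Reasoning
    u : ℚ
    u = ℤ.+ 1 / suc (p ℕ.+ k)
    u-inverse : u * (1ℚ + (nat p + nat k)) ≡ 1ℚ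
    u-inverse = begin
      u * (1ℚ + (nat p + nat k))  ≡⟨ cong (λ t → u * (1ℚ + t)) (nat-+ p k) ⟨
      u * (1ℚ + nat (p ℕ.+ k))    ≡⟨ cong (u *_) (nat-+ 1 (p ℕ.+ k)) ⟨
      u * nat (suc (p ℕ.+ k))     ≡⟨ 1/suc-inverseˡ (p ℕ.+ k) ⟩
      1ℚ                          ∎
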